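{- If $w\in S_n$ is chosen uniformly at random, then $\Pr[w \text{ is } I\text{ -spherical for some } I\subseteq J(w)]\to 0$ as $n\to\infty$. In particular, $\Pr[w \text{ is maximally spherical}]\to 0$ as $n\to\infty$.
   Context: For $w\in S_n$, $J(w)=\{i\in[n-1]: w^{ -1}(i+1)<w^{ -1}(i)\}$ and $\ell(w)$ is the number of inversions of $w$. Let $s_i=(i\ i+1)$; an expression $w=s_{i_1}\cdots s_{i_\ell}$ is reduced if $\ell=\ell(w)$. For $I\subseteq J(w)$ write $[n-1]\setminus I=\{d_1<\cdots<d_k\}$, $d_0=0$, $d_{k+1}=n$. Then $w$ is $I$-spherical if there is a reduced expression $s_{i_1}\cdots s_{i_{\ell(w)}}$ for $w$ such that (I) each $s_{d_i}$, $1\le i\le k$, appears at most once in it, and (II) $\#\{m: d_{t-1}<i_m<d_t\}\le\binom{d_t-d_{t-1}+1}{2}-1$ for each $1\le t\le k+1$. $w$ is maximally spherical if it is $J(w)$-spherical. -}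

module Defs where

open import Data.Nat using (ℕ; zero; suc; _+_; _*_; _∸_; _≤_; _<_; _<?_; _≡ᵇ_)
open import Data.Nat.Combinatorics using (_C_)
open import Data.Nat using (_!)
open import Data.Bool using (Bool; true; false; if_then_else_)
open import Data.List using (List; []; _∷_; length; map; foldl; upTo; filter)
open import Data.List.Relation.Unary.All using (All)
open import Data.List.Relation.Unary.Unique.Propositional using (Unique)
open import Data.List.Membership.Propositional using (_∈_; _∉_)
open import Data.List.Relation.Binary.Permutation.Propositional using (_↭_)
open import Data.Product using (Σ; ∃; _×_; _,_)
open import Data.Sum using (_⊎_)
open import Function.Bundles using (_⇔_)
open import Relation.Binary.PropositionalEquality using (_≡_)
open import Relation.Nullary.Decidable using (_×-dec_)

-- Permutations w ∈ S_n are given in one-line notation [w(1), …, w(n)]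
-- as lists of naturals that are a rearrangement of [1, …, n].
idPerm : ℕ → List ℕ
idPerm n = map suc (upTo n)

IsPerm : ℕ → List ℕ → Set
IsPerm n w = w ↭ idPerm n

-- w⁻¹(v): the (1-indexed) position of the value v in w.
pos : ℕ → List ℕ → ℕ
pos v []       = 0
pos v (x ∷ xs) = if x ≡ᵇ v then 1 else suc (pos v xs)

InJ : ℕ → List ℕ → ℕ → Set
InJ n w i = (1 ≤ i) × (i ≤ n ∸ 1) × (pos (suc i) w < pos i w)

inv : List ℕ → ℕ
inv []       = 0
inv (x ∷ xs) = length (filter (_<? x) xs) + inv xs

-- Right multiplication by s_i = (i i+1) swaps positions i and i+1 (1-indexed).
swapAt : ℕ → List ℕ → List ℕ
swapAt (suc zero)    (x ∷ y ∷ xs) = y ∷ x ∷ xs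
swapAt (suc (suc i)) (x ∷ xs)     = x ∷ swapAt (suc i) xs
swapAt _             xs           = xs

-- The product s_{i_1} s_{i_2} ⋯ s_{i_ℓ} (composition of functions) in S_n,
-- in one-line notation.
prod : ℕ → List ℕ → List ℕ
prod n ws = foldl (λ u i → swapAt i u) (idPerm n) ws

Reduced : ℕ → List ℕ → List ℕ → Set
Reduced n w ws = All (λ i → (1 ≤ i) × (i ≤ n ∸ 1)) ws
               × (length ws ≡ inv w)
               × (prod n ws ≡ w)

occ : ℕ → List ℕ → ℕ
occ d ws = length (filter (λ x → x Data.Nat.≟ d) ws)

between : ℕ → ℕ → List ℕ → ℕ
between a b ws = length (filter (λ x → (a <? x) ×-dec (x <? b)) ws)

InD : ℕ → List ℕ → ℕ → Set
InD n I d = (d ≡ 0) ⊎ ((1 ≤ d) × (d ≤ n ∸ 1) × d ∉ I) ⊎ (d ≡ n)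

-- a < b are consecutive elements of {0} ∪ ([n-1] ∖ I) ∪ {n},
-- i.e. a = d_{t-1}, b = d_t for some 1 ≤ t ≤ k+1.
Consecutive : ℕ → List ℕ → ℕ → ℕ → Set
Consecutive n I a b = InD n I a × InD n I b × (a < b)
                    × (∀ c → a < c → c < b → c ∈ I)

-- w is I-spherical (I given as a list; only membership in I matters).
ISpherical : ℕ → List ℕ → List ℕ → Set
ISpherical n w I = Σ (List ℕ) λ ws →
    Reduced n w ws
  × (∀ d → 1 ≤ d → d ≤ n ∸ 1 → d ∉ I → occ d ws ≤ 1)
  × (∀ a b → Consecutive n I a b → between a b ws ≤ ((b ∸ a) + 1) C 2 ∸ 1)

SomeSpherical : ℕ → List ℕ → Set
SomeSpherical n w = Σ (List ℕ) λ I → All (InJ n w) I × ISpherical n w I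

MaxSpherical : ℕ → List ℕ → Set
MaxSpherical n w = Σ (List ℕ) λ I → (∀ i → (i ∈ I) ⇔ InJ n w i) × ISpherical n w I

-- Pr[P] → 0 for uniformly random w ∈ S_n:  for every k there is N such that
-- for all n ≥ N, k · #{w ∈ S_n : P w} < n!.  The count #{w ∈ S_n : P w} is
-- expressed as: every duplicate-free list of permutations satisfying P has
-- length L with k · L < n!.
ProbTendsToZero : (ℕ → List ℕ → Set) → Set
ProbTendsToZero P = ∀ (k : ℕ) → ∃ λ (N : ℕ) → ∀ (n : ℕ) → N ≤ n →
  ∀ (L : List (List ℕ)) → Unique L → All (λ w → IsPerm n w × P n w) L →
  k * length L < n !

-- The values are cut into blocks (the intervals (d_{t-1}, d_t]); each block is a run of
-- descents of w, so its values occur in w in decreasing order, which forces Σ_t C(j_t, 2) inversions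
-- (j_t the block sizes). Conditions (I) and (II) bound ℓ(w) by Σ_t C(j_t + 1, 2) = Σ_t C(j_t, 2) + n,
-- so w has at most n inversions between different blocks. Recording for every entry of w the number
-- of later entries in earlier blocks gives a list of n naturals with sum at most n which, together with
-- the indicator of I, determines w. These codes are lists of length 2n with sum at most 2n, of which
-- there are at most 2^{4n} = 16^n; and k · 16^n < n! for n large.
module Submission where

open import Data.Bool using (Bool; true; false; not; if_then_else_; T)
open import Data.Bool.Properties using (not-injective)
open import Data.Empty using (⊥-elim)
open import Data.List using (List; []; _∷_; [_]; length; map; filter; _++_; applyUpTo)
open import Data.List.Properties
  using (∷-injective; length-++; length-++-sucʳ; length-map; length-applyUpTo; map-++; map-applyUpTo;
         map-cong-local; map-injective; ++-assoc; filter-all; filter-none; filter-accept)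
open import Data.List.Membership.Propositional using (_∈_; _∉_)
open import Data.List.Membership.Propositional.Properties
  using (∈-∃++; ∈-++⁻; ∈-++⁺ˡ; ∈-++⁺ʳ; ∈-map⁺; ∈-filter⁺; ∈-filter⁻)
open import Data.List.Relation.Binary.Permutation.Propositional using (_↭_; ↭-sym; ↭-trans; ↭⇒↭ₛ)
open import Data.List.Relation.Binary.Permutation.Propositional.Properties using (∈-resp-↭; drop-∷; ↭-length; map⁺)
import Data.List.Relation.Binary.Permutation.Setoid.Properties as PermutationProperties
open import Data.List.Relation.Binary.Subset.Propositional using (_⊆_)
open import Data.List.Relation.Unary.All as All using (All; []; _∷_)
open import Data.List.Relation.Unary.AllPairs using (AllPairs; []; _∷_)
open import Data.List.Relation.Unary.Any using (here; there)
open import Data.List.Relation.Unary.Unique.Propositional as Unique using (Unique)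
open import Data.List.Relation.Unary.Unique.Propositional.Properties using () renaming (filter⁺ to Unique-filter⁺)
open import Data.Nat
open import Data.Nat.Combinatorics using (_C_; nCk+nC[k+1]≡[n+1]C[k+1]; nC1≡n)
open import Data.Nat.ListAction using (sum)
open import Data.Nat.ListAction.Properties using (sum-↭; sum-++)
open import Data.Nat.Properties
open import Data.Nat.Solver using (module +-*-Solver)
open +-*-Solver using (solve; _:+_; _:*_; _:=_; con)
open import Data.Product as Product using (Σ; ∃; _×_; _,_; proj₁; proj₂)
open import Data.Sum using (_⊎_; inj₁; inj₂; swap)
open import Function using (_∘_; id)
open import Function.Bundles using (Equivalence)
open import Level using (0ℓ)
open import Relation.Binary.Definitions using (tri<; tri≈; tri>)
open import Relation.Binary.PropositionalEquality hiding ([_])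
open import Relation.Nullary using (¬_; does; yes; no)
open import Relation.Nullary.Decidable using (_×-dec_; dec-true)
open import Relation.Unary using (Pred; Decidable)

open import Defs
open import Data.List.Membership.DecPropositional _≟_ using (_∈?_)

module _ {A B : Set} where

  length≤-of-injective-code : (R : A → B → Set) → (∀ {a a′ b} → R a b → R a′ b → a ≡ a′) →
                              ∀ {xs} ys → Unique xs → All (λ a → ∃ λ b → b ∈ ys × R a b) xs →
                              length xs ≤ length ys
  length≤-of-injective-code R R-inj ys [] [] = z≤n
  length≤-of-injective-code R R-inj {a ∷ _} ys (a∉xs ∷ xs!) ((b , b∈ys , Rab) ∷ codes)
    with us , vs , refl ← ∈-∃++ b∈ys =
    ≤-trans (s≤s (length≤-of-injective-code R R-inj (us ++ vs) xs! (All.zipWith (λ (a≢a′ , code) → moveCode a≢a′ code) (a∉xs , codes))))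
            (≤-reflexive (sym (length-++-sucʳ us b vs)))
    where
    moveCode : ∀ {a′} → a ≢ a′ → ∃ (λ b′ → b′ ∈ us ++ b ∷ vs × R a′ b′) → ∃ λ b′ → b′ ∈ us ++ vs × R a′ b′
    moveCode a≢a′ (b′ , b′∈ , Ra′b′) with ∈-++⁻ us b′∈
    ... | inj₁ b′∈us = b′ , ∈-++⁺ˡ b′∈us , Ra′b′
    ... | inj₂ (here refl) = ⊥-elim (a≢a′ (R-inj Rab Ra′b′))
    ... | inj₂ (there b′∈vs) = b′ , ∈-++⁺ʳ us b′∈vs , Ra′b′

unique-⊆⇒length≤ : ∀ {A : Set} {xs ys : List A} → Unique xs → xs ⊆ ys → length xs ≤ length ys
unique-⊆⇒length≤ {xs = xs} {ys} xs! xs⊆ys =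
  length≤-of-injective-code _≡_ (λ p q → trans p (sym q)) ys xs! (All.tabulate (λ x∈xs → _ , xs⊆ys x∈xs , refl))

Unique-resp-↭ : ∀ {A : Set} {xs ys : List A} → xs ↭ ys → Unique xs → Unique ys
Unique-resp-↭ {A} p = PermutationProperties.Unique-resp-↭ (setoid A) (↭⇒↭ₛ p)

length-filter-≤-∷ : ∀ {A : Set} {S : Pred A 0ℓ} (S? : Decidable S) x xs → length (filter S? xs) ≤ length (filter S? (x ∷ xs))
length-filter-≤-∷ S? x xs with S? x
... | yes _ = n≤1+n _
... | no _  = ≤-refl

module _ {A : Set} {P Q R : Pred A 0ℓ} (P? : Decidable P) (Q? : Decidable Q) (R? : Decidable R) where

  length-filter-⊎ : (∀ x → P x → Q x ⊎ R x) →
                    ∀ xs → length (filter P? xs) ≤ length (filter Q? xs) + length (filter R? xs)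
  length-filter-⊎ P⊆Q∪R [] = z≤n
  length-filter-⊎ P⊆Q∪R (x ∷ xs) with P? x
  ... | no _ = ≤-trans (length-filter-⊎ P⊆Q∪R xs) (+-mono-≤ (length-filter-≤-∷ Q? x xs) (length-filter-≤-∷ R? x xs))
  ... | yes Px with P⊆Q∪R x Px
  ...   | inj₁ Qx = ≤-trans (s≤s (length-filter-⊎ P⊆Q∪R xs))
                      (+-mono-≤ (≤-reflexive (cong length (sym (filter-accept Q? Qx)))) (length-filter-≤-∷ R? x xs))
  ...   | inj₂ Rx = ≤-trans (s≤s (length-filter-⊎ P⊆Q∪R xs))
                      (≤-trans (≤-reflexive (sym (+-suc _ _)))
                        (+-mono-≤ (length-filter-≤-∷ Q? x xs) (≤-reflexive (cong length (sym (filter-accept R? Rx))))))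

  length-filter-disjoint : (∀ x → Q x → P x) → (∀ x → R x → P x) → (∀ x → Q x → ¬ R x) →
                           ∀ xs → length (filter Q? xs) + length (filter R? xs) ≤ length (filter P? xs)
  length-filter-disjoint Q⊆P R⊆P Q∩R=∅ [] = z≤n
  length-filter-disjoint Q⊆P R⊆P Q∩R=∅ (x ∷ xs) with Q? x | R? x | P? x
  ... | yes Qx | yes Rx | _     = ⊥-elim (Q∩R=∅ x Qx Rx)
  ... | yes Qx | no _   | yes _ = s≤s (length-filter-disjoint Q⊆P R⊆P Q∩R=∅ xs)
  ... | yes Qx | no _   | no ¬P = ⊥-elim (¬P (Q⊆P x Qx))
  ... | no _   | yes Rx | yes _ = ≤-trans (≤-reflexive (+-suc _ _)) (s≤s (length-filter-disjoint Q⊆P R⊆P Q∩R=∅ xs))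
  ... | no _   | yes Rx | no ¬P = ⊥-elim (¬P (R⊆P x Rx))
  ... | no _   | no _   | yes _ = m≤n⇒m≤1+n (length-filter-disjoint Q⊆P R⊆P Q∩R=∅ xs)
  ... | no _   | no _   | no _  = length-filter-disjoint Q⊆P R⊆P Q∩R=∅ xs

interval : ℕ → ℕ → List ℕ
interval a zero    = []
interval a (suc m) = a ∷ interval (suc a) m

∈-interval⁻ : ∀ {a m y} → y ∈ interval a m → a ≤ y × y < a + m
∈-interval⁻ {a} {suc m} (here refl) = ≤-refl , m<m+n a (s≤s z≤n)
∈-interval⁻ {a} {suc m} {y} (there y∈) with a<y , y<a+1+m ← ∈-interval⁻ y∈ =
  <⇒≤ a<y , subst (y <_) (sym (+-suc a m)) y<a+1+m

∈-interval⁺ : ∀ {a m y} → a ≤ y → y < a + m → y ∈ interval a m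
∈-interval⁺ {a} {zero} {y} a≤y y<a+0 = ⊥-elim (<⇒≱ (subst (y <_) (+-identityʳ a) y<a+0) a≤y)
∈-interval⁺ {a} {suc m} {y} a≤y y<a+m with m≤n⇒m<n∨m≡n a≤y
... | inj₂ refl = here refl
... | inj₁ a<y  = there (∈-interval⁺ a<y (subst (y <_) (+-suc a m) y<a+m))

length-interval : ∀ a m → length (interval a m) ≡ m
length-interval a zero    = refl
length-interval a (suc m) = cong suc (length-interval (suc a) m)

interval-unique : ∀ a m → Unique (interval a m)
interval-unique a zero    = []
interval-unique a (suc m) =
  All.tabulate (λ y∈ → <⇒≢ (proj₁ (∈-interval⁻ y∈))) ∷ interval-unique (suc a) m

interval-++ : ∀ a j m → interval a (j + m) ≡ interval a j ++ interval (a + j) m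
interval-++ a zero    m = cong (λ b → interval b m) (sym (+-identityʳ a))
interval-++ a (suc j) m =
  cong (a ∷_) (trans (interval-++ (suc a) j m) (cong (λ b → interval (suc a) j ++ interval b m) (sym (+-suc a j))))

applyUpTo≡interval : ∀ (f : ℕ → ℕ) a n → (∀ i → f i ≡ a + i) → applyUpTo f n ≡ interval a n
applyUpTo≡interval f a zero    f≗a+ = refl
applyUpTo≡interval f a (suc n) f≗a+ =
  cong₂ _∷_ (trans (f≗a+ 0) (+-identityʳ a)) (applyUpTo≡interval (f ∘ suc) (suc a) n (λ i → trans (f≗a+ (suc i)) (+-suc a i)))

idPerm≡interval : ∀ n → idPerm n ≡ interval 1 n
idPerm≡interval n = trans (map-applyUpTo id suc n) (applyUpTo≡interval suc 1 n (λ _ → refl))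

[1+j]C2≡j+jC2 : ∀ j → suc j C 2 ≡ j + j C 2
[1+j]C2≡j+jC2 j = trans (sym (nCk+nC[k+1]≡[n+1]C[k+1] j 1)) (cong (_+ j C 2) (nC1≡n j))

1≤[1+j]C2 : ∀ {j} → 0 < j → 1 ≤ suc j C 2
1≤[1+j]C2 {suc j} _ = subst (1 ≤_) (sym ([1+j]C2≡j+jC2 (suc j))) (s≤s z≤n)

sum-interval-ranks : ∀ s j → sum (map (λ v → suc (v ∸ s)) (interval s j)) ≡ suc j C 2
sum-interval-ranks s zero    = refl
sum-interval-ranks s (suc j) = begin
  sum (map rank (interval s (suc j)))                ≡⟨ cong (sum ∘ map rank) (trans (cong (interval s) (+-comm 1 j)) (interval-++ s j 1)) ⟩
  sum (map rank (interval s j ++ [ s + j ]))         ≡⟨ cong sum (map-++ rank (interval s j) [ s + j ]) ⟩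
  sum (map rank (interval s j) ++ [ rank (s + j) ])  ≡⟨ sum-++ (map rank (interval s j)) [ rank (s + j) ] ⟩
  sum (map rank (interval s j)) + (rank (s + j) + 0) ≡⟨ cong₂ _+_ (sum-interval-ranks s j) (trans (+-identityʳ _) (cong suc (m+n∸m≡n s j))) ⟩
  suc j C 2 + suc j                                  ≡⟨ +-comm (suc j C 2) (suc j) ⟩
  suc j + suc j C 2                                  ≡⟨ sym ([1+j]C2≡j+jC2 (suc j)) ⟩
  suc (suc j) C 2                                    ∎
  where
  open ≡-Reasoning
  rank : ℕ → ℕ
  rank v = suc (v ∸ s)

interval-split : ∀ {a b n} → a ≤ b → b ≤ n → interval a (n ∸ a) ≡ interval a (b ∸ a) ++ interval b (n ∸ b)
interval-split {a} {b} {n} a≤b b≤n = begin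
  interval a (n ∸ a)                         ≡⟨ cong (interval a) (sym [b∸a]+[n∸b]≡n∸a) ⟩
  interval a ((b ∸ a) + (n ∸ b))             ≡⟨ interval-++ a (b ∸ a) (n ∸ b) ⟩
  interval a (b ∸ a) ++ interval (a + (b ∸ a)) (n ∸ b) ≡⟨ cong (λ c → interval a (b ∸ a) ++ interval c (n ∸ b)) (m+[n∸m]≡n a≤b) ⟩
  interval a (b ∸ a) ++ interval b (n ∸ b)   ∎
  where
  open ≡-Reasoning
  [b∸a]+[n∸b]≡n∸a : (b ∸ a) + (n ∸ b) ≡ n ∸ a
  [b∸a]+[n∸b]≡n∸a = +-cancelˡ-≡ a _ _ (begin
    a + ((b ∸ a) + (n ∸ b)) ≡⟨ sym (+-assoc a (b ∸ a) (n ∸ b)) ⟩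
    a + (b ∸ a) + (n ∸ b)   ≡⟨ cong (_+ (n ∸ b)) (m+[n∸m]≡n a≤b) ⟩
    b + (n ∸ b)             ≡⟨ m+[n∸m]≡n b≤n ⟩
    n                       ≡⟨ sym (m+[n∸m]≡n (≤-trans a≤b b≤n)) ⟩
    a + (n ∸ a)             ∎)

incrementHead : List ℕ → List ℕ
incrementHead []       = []
incrementHead (x ∷ xs) = suc x ∷ xs

boundedSumLists : ℕ → ℕ → List (List ℕ)
boundedSumLists zero    B       = [ [] ]
boundedSumLists (suc n) zero    = map (0 ∷_) (boundedSumLists n zero)
boundedSumLists (suc n) (suc B) = map (0 ∷_) (boundedSumLists n (suc B)) ++ map incrementHead (boundedSumLists (suc n) B)

length-boundedSumLists : ∀ n B → length (boundedSumLists n B) ≤ 2 ^ (n + B)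
length-boundedSumLists zero    B       = m^n>0 2 B
length-boundedSumLists (suc n) zero    = begin
  length (map (0 ∷_) (boundedSumLists n 0)) ≡⟨ length-map _ (boundedSumLists n 0) ⟩
  length (boundedSumLists n 0)               ≤⟨ length-boundedSumLists n 0 ⟩
  2 ^ (n + 0)                                ≤⟨ m≤m+n _ _ ⟩
  2 ^ suc (n + 0)                            ∎
  where open ≤-Reasoning
length-boundedSumLists (suc n) (suc B) = begin
  length (map (0 ∷_) (boundedSumLists n (suc B)) ++ map incrementHead (boundedSumLists (suc n) B))
    ≡⟨ length-++ (map (0 ∷_) (boundedSumLists n (suc B))) ⟩
  length (map (0 ∷_) (boundedSumLists n (suc B))) + length (map incrementHead (boundedSumLists (suc n) B))
    ≡⟨ cong₂ _+_ (length-map _ (boundedSumLists n (suc B))) (length-map incrementHead (boundedSumLists (suc n) B)) ⟩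
  length (boundedSumLists n (suc B)) + length (boundedSumLists (suc n) B)
    ≤⟨ +-mono-≤ (length-boundedSumLists n (suc B)) (length-boundedSumLists (suc n) B) ⟩
  2 ^ (n + suc B) + 2 ^ (suc n + B)
    ≡⟨ cong (λ e → 2 ^ (n + suc B) + 2 ^ e) (sym (+-suc n B)) ⟩
  2 ^ (n + suc B) + 2 ^ (n + suc B)
    ≡⟨ cong (2 ^ (n + suc B) +_) (sym (+-identityʳ _)) ⟩
  2 ^ suc (n + suc B) ∎
  where open ≤-Reasoning

∈-boundedSumLists : ∀ n B xs → length xs ≡ n → sum xs ≤ B → xs ∈ boundedSumLists n B
∈-boundedSumLists zero    B       []           refl _         = here refl
∈-boundedSumLists (suc n) zero    (zero ∷ xs)  refl Σxs≤0     = ∈-map⁺ (0 ∷_) (∈-boundedSumLists n 0 xs refl Σxs≤0)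
∈-boundedSumLists (suc n) (suc B) (zero ∷ xs)  refl Σxs≤1+B   =
  ∈-++⁺ˡ (∈-map⁺ (0 ∷_) (∈-boundedSumLists n (suc B) xs refl Σxs≤1+B))
∈-boundedSumLists (suc n) (suc B) (suc x ∷ xs) refl (s≤s Σ≤B) =
  ∈-++⁺ʳ (map (0 ∷_) (boundedSumLists n (suc B))) (∈-map⁺ incrementHead (∈-boundedSumLists (suc n) B (x ∷ xs) refl Σ≤B))

n<2^n : ∀ n → n < 2 ^ n
n<2^n zero    = s≤s z≤n
n<2^n (suc n) = +-mono-≤-< (m^n>0 2 n) (subst (n <_) (sym (+-identityʳ (2 ^ n))) (n<2^n n))

module _ (c B : ℕ) .{{_ : NonZero c}} (2c≤1+B : 2 * c ≤ suc B) (c^B≤B! : c ^ B ≤ B !) where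

  2^m*c^[B+m]≤[B+m]! : ∀ m → 2 ^ m * c ^ (B + m) ≤ (B + m) !
  2^m*c^[B+m]≤[B+m]! zero = subst₂ _≤_ (sym (trans (+-identityʳ _) (cong (c ^_) (+-identityʳ B)))) (cong _! (sym (+-identityʳ B))) c^B≤B!
  2^m*c^[B+m]≤[B+m]! (suc m) = begin
    2 ^ suc m * c ^ (B + suc m)      ≡⟨ cong (λ e → 2 ^ suc m * c ^ e) (+-suc B m) ⟩
    (2 * 2 ^ m) * (c * c ^ (B + m))  ≡⟨ solve 3 (λ c x y → (con 2 :* x) :* (c :* y) := (con 2 :* c) :* (x :* y)) refl c (2 ^ m) (c ^ (B + m)) ⟩
    (2 * c) * (2 ^ m * c ^ (B + m))  ≤⟨ *-mono-≤ (≤-trans 2c≤1+B (s≤s (m≤m+n B m))) (2^m*c^[B+m]≤[B+m]! m) ⟩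
    suc (B + m) !                    ≡⟨ cong _! (sym (+-suc B m)) ⟩
    (B + suc m) !                    ∎
    where open ≤-Reasoning

  *-^<! : ∀ k n → B + k ≤ n → k * c ^ n < n !
  *-^<! k n B+k≤n with o , refl ← m≤n⇒∃[o]m+o≡n B+k≤n = begin-strict
    k * c ^ (B + k + o)             <⟨ *-monoˡ-< (c ^ (B + k + o)) {{m^n≢0 c (B + k + o)}} (<-≤-trans (n<2^n k) (^-monoʳ-≤ 2 (m≤m+n k o))) ⟩
    2 ^ (k + o) * c ^ (B + k + o)   ≡⟨ cong (λ e → 2 ^ (k + o) * c ^ e) (+-assoc B k o) ⟩
    2 ^ (k + o) * c ^ (B + (k + o)) ≤⟨ 2^m*c^[B+m]≤[B+m]! (k + o) ⟩
    (B + (k + o)) !                 ≡⟨ cong _! (sym (+-assoc B k o)) ⟩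
    (B + k + o) !                   ∎
    where open ≤-Reasoning

≤∸1⇒< : ∀ {d n} → 1 ≤ d → d ≤ n ∸ 1 → d < n
≤∸1⇒< {suc d} {suc n} _ d≤n = s≤s d≤n

<⇒≤∸1 : ∀ {d n} → d < n → d ≤ n ∸ 1
<⇒≤∸1 {d} {suc n} (s≤s d≤n) = d≤n

flagAt : List Bool → ℕ → Bool
flagAt []       d       = false
flagAt (b ∷ bs) zero    = b
flagAt (b ∷ bs) (suc d) = flagAt bs d

flagAt-applyUpTo : ∀ (f : ℕ → Bool) n {d} → flagAt (applyUpTo f n) d ≡ true → f d ≡ true
flagAt-applyUpTo f (suc n) {zero}  fd≡true = fd≡true
flagAt-applyUpTo f (suc n) {suc d} flag≡true = flagAt-applyUpTo (f ∘ suc) n flag≡true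

flagAt-applyUpTo< : ∀ (f : ℕ → Bool) {n d} → d < n → flagAt (applyUpTo f n) d ≡ f d
flagAt-applyUpTo< f {suc n} {zero}  _         = refl
flagAt-applyUpTo< f {suc n} {suc d} (s≤s d<n) = flagAt-applyUpTo< (f ∘ suc) d<n

fromBool : Bool → ℕ
fromBool false = 0
fromBool true  = 1

fromBool-injective : ∀ {b c} → fromBool b ≡ fromBool c → b ≡ c
fromBool-injective {false} {false} _ = refl
fromBool-injective {true}  {true}  _ = refl

sum-map-fromBool≤length : ∀ bs → sum (map fromBool bs) ≤ length bs
sum-map-fromBool≤length []           = z≤n
sum-map-fromBool≤length (false ∷ bs) = m≤n⇒m≤1+n (sum-map-fromBool≤length bs)
sum-map-fromBool≤length (true ∷ bs)  = s≤s (sum-map-fromBool≤length bs)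

sum-map-suc : ∀ (f : ℕ → ℕ) xs → sum (map (suc ∘ f) xs) ≡ sum (map f xs) + length xs
sum-map-suc f []       = refl
sum-map-suc f (x ∷ xs) = begin
  suc (f x + sum (map (suc ∘ f) xs))   ≡⟨ cong (λ s → suc (f x + s)) (sum-map-suc f xs) ⟩
  suc (f x + (sum (map f xs) + length xs)) ≡⟨ cong suc (sym (+-assoc (f x) _ _)) ⟩
  suc (f x + sum (map f xs) + length xs) ≡⟨ sym (+-suc _ (length xs)) ⟩
  f x + sum (map f xs) + suc (length xs) ∎
  where open ≡-Reasoning

++-injective : ∀ {A : Set} (xs ys : List A) {us vs} → length xs ≡ length ys → xs ++ us ≡ ys ++ vs → xs ≡ ys × us ≡ vs
++-injective []       []       _   eq = refl , eq
++-injective (x ∷ xs) (y ∷ ys) len eq with refl , eq′ ← ∷-injective eq with xs≡ys , us≡vs ← ++-injective xs ys (suc-injective len) eq′ =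
  cong (x ∷_) xs≡ys , us≡vs

pos-head : ∀ x xs → pos x (x ∷ xs) ≡ 1
pos-head x xs with x ≡ᵇ x in x≡ᵇx
... | true  = refl
... | false = ⊥-elim (subst T x≡ᵇx (≡⇒≡ᵇ x x refl))

pos-∷ : ∀ {y x} xs → y ≢ x → pos y (x ∷ xs) ≡ suc (pos y xs)
pos-∷ {y} {x} xs y≢x with x ≡ᵇ y in x≡ᵇy
... | true  = ⊥-elim (y≢x (sym (≡ᵇ⇒≡ x y (subst T (sym x≡ᵇy) _))))
... | false = refl

pos-∈ : ∀ {y xs} → y ∈ xs → 0 < pos y xs
pos-∈ {y} {x ∷ xs} _ with x ≡ᵇ y
... | true  = s≤s z≤n
... | false = s≤s z≤n

pos<pos : ∀ pre {x xs y} → Unique (pre ++ x ∷ xs) → y ∈ xs → pos x (pre ++ x ∷ xs) < pos y (pre ++ x ∷ xs)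
pos<pos [] {x} {xs} {y} (x∉xs ∷ _) y∈xs
  rewrite pos-head x xs | pos-∷ xs (≢-sym (All.lookup x∉xs y∈xs)) = s≤s (pos-∈ y∈xs)
pos<pos (p ∷ pre) {x} {xs} {y} (p∉ ∷ pre++x∷xs!) y∈xs
  rewrite pos-∷ (pre ++ x ∷ xs) (≢-sym (All.lookup p∉ (∈-++⁺ʳ pre (here refl))))
        | pos-∷ (pre ++ x ∷ xs) (≢-sym (All.lookup p∉ (∈-++⁺ʳ pre (there y∈xs))))
  = s≤s (pos<pos pre pre++x∷xs! y∈xs)

lettersAbove : ℕ → List ℕ → ℕ
lettersAbove a ws = length (filter (a <?_) ws)

lettersAbove-split : ∀ a b ws → lettersAbove a ws ≤ between a b ws + (occ b ws + lettersAbove b ws)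
lettersAbove-split a b ws =
  ≤-trans (length-filter-⊎ (a <?_) (λ x → (a <? x) ×-dec (x <? b)) (b ≤?_) belowOrAbove ws)
          (+-monoʳ-≤ _ (length-filter-⊎ (b ≤?_) (_≟ b) (b <?_) (λ x b≤x → ≡-or-> (m≤n⇒m<n∨m≡n b≤x)) ws))
  where
  belowOrAbove : ∀ x → a < x → (a < x × x < b) ⊎ b ≤ x
  belowOrAbove x a<x with x <? b
  ... | yes x<b = inj₁ (a<x , x<b)
  ... | no x≮b  = inj₂ (≮⇒≥ x≮b)
  ≡-or-> : ∀ {x} → b < x ⊎ b ≡ x → x ≡ b ⊎ b < x
  ≡-or-> (inj₁ b<x) = inj₂ b<x
  ≡-or-> (inj₂ b≡x) = inj₁ (sym b≡x)

descents⇒pos< : ∀ w {x y} → x < y → (∀ i → x ≤ i → i < y → pos (suc i) w < pos i w) → pos y w < pos x w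
descents⇒pos< w {x} {suc y} x<1+y descent with m≤n⇒m<n∨m≡n (≤-pred x<1+y)
... | inj₂ refl = descent x ≤-refl ≤-refl
... | inj₁ x<y  = <-trans (descent y (<⇒≤ x<y) ≤-refl) (descents⇒pos< w x<y (λ i x≤i i<y → descent i x≤i (m≤n⇒m≤1+n i<y)))

-- The paper's d₀ = 0 < d₁ < ⋯ are the boundaries below n; the block of a
-- value x > 0 is (boundaryBelow x, next boundary], and offset x counts the smaller values of its block.
module Blocks (inI : ℕ → Bool) where

  isBoundary : ℕ → Bool
  isBoundary zero    = true
  isBoundary (suc d) = not (inI (suc d))

  boundaryBelow : ℕ → ℕ
  boundaryBelow zero    = zero
  boundaryBelow (suc d) = if isBoundary d then d else boundaryBelow d

  offset : ℕ → ℕ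
  offset x = x ∸ suc (boundaryBelow x)

  nonBoundary⇒∈I : ∀ i → isBoundary i ≡ false → inI i ≡ true
  nonBoundary⇒∈I zero    ()
  nonBoundary⇒∈I (suc i) isBoundary≡false = not-injective isBoundary≡false

  boundaryBelow≤ : ∀ x → boundaryBelow x ≤ x
  boundaryBelow≤ zero    = z≤n
  boundaryBelow≤ (suc d) with isBoundary d
  ... | true  = n≤1+n d
  ... | false = m≤n⇒m≤1+n (boundaryBelow≤ d)

  boundaryBelow< : ∀ {x} → 0 < x → boundaryBelow x < x
  boundaryBelow< {suc d} _ with isBoundary d
  ... | true  = ≤-refl
  ... | false = s≤s (boundaryBelow≤ d)

  inside-block⇒∈I : ∀ x i → boundaryBelow x < i → i < x → inI i ≡ true
  inside-block⇒∈I (suc d) i below<i i<1+d with isBoundary d in isBoundary-d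
  ... | true  = ⊥-elim (<⇒≱ below<i (≤-pred i<1+d))
  ... | false with m≤n⇒m<n∨m≡n (≤-pred i<1+d)
  ...   | inj₂ refl = nonBoundary⇒∈I i isBoundary-d
  ...   | inj₁ i<d  = inside-block⇒∈I d i below<i i<d

  boundaryBelow-unique : ∀ a v → isBoundary a ≡ true → a < v →
                         (∀ i → a < i → i < v → isBoundary i ≡ false) → boundaryBelow v ≡ a
  boundaryBelow-unique a (suc d) isBoundary-a a<1+d none with m≤n⇒m<n∨m≡n (≤-pred a<1+d)
  ... | inj₂ refl rewrite isBoundary-a = refl
  ... | inj₁ a<d  rewrite none d a<d ≤-refl =
    boundaryBelow-unique a d isBoundary-a a<d (λ i a<i i<d → none i a<i (m≤n⇒m≤1+n i<d))

  EarlierBlock : ℕ → ℕ → Set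
  EarlierBlock x y = x < y → x ≤ boundaryBelow y

  BlockDecreasing : List ℕ → Set
  BlockDecreasing = AllPairs EarlierBlock

  BlockClosed : List ℕ → Set
  BlockClosed w = ∀ {x} → x ∈ w → ∀ y → boundaryBelow x < y → y < x → y ∈ w

  -- A Lehmer code relative to the blocks: entry i counts the later values in strictly earlier blocks.
  crossCode : List ℕ → List ℕ
  crossCode []       = []
  crossCode (x ∷ xs) = length (filter (_≤? boundaryBelow x) xs) ∷ crossCode xs

  length-crossCode : ∀ w → length (crossCode w) ≡ length w
  length-crossCode []      = refl
  length-crossCode (x ∷ w) = cong suc (length-crossCode w)

  offset≤#sameBlockBelow : ∀ {x xs} → 0 < x → BlockClosed (x ∷ xs) →
                           offset x ≤ length (filter (λ y → (boundaryBelow x <? y) ×-dec (y <? x)) xs)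
  offset≤#sameBlockBelow {x} {xs} 0<x closed = begin
    offset x                                             ≡⟨ sym (length-interval _ (offset x)) ⟩
    length (interval (suc (boundaryBelow x)) (offset x)) ≤⟨ unique-⊆⇒length≤ (interval-unique _ _) block⊆ ⟩
    length (filter (λ y → (boundaryBelow x <? y) ×-dec (y <? x)) xs) ∎
    where
    open ≤-Reasoning
    block⊆ : interval (suc (boundaryBelow x)) (offset x) ⊆ filter (λ y → (boundaryBelow x <? y) ×-dec (y <? x)) xs
    block⊆ {y} y∈ = inTail (closed (here refl) y below<y y<x)
      where
      below<y : boundaryBelow x < y
      below<y = proj₁ (∈-interval⁻ y∈)
      y<x : y < x
      y<x = subst (y <_) (m+[n∸m]≡n (boundaryBelow< 0<x)) (proj₂ (∈-interval⁻ y∈))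
      inTail : y ∈ x ∷ xs → y ∈ filter (λ y → (boundaryBelow x <? y) ×-dec (y <? x)) xs
      inTail (here refl)  = ⊥-elim (<-irrefl refl y<x)
      inTail (there y∈xs) = ∈-filter⁺ _ y∈xs (below<y , y<x)

  crossCodeHead+offset≤ : ∀ {x xs} → 0 < x → BlockClosed (x ∷ xs) →
                          length (filter (_≤? boundaryBelow x) xs) + offset x ≤ length (filter (_<? x) xs)
  crossCodeHead+offset≤ {x} {xs} 0<x closed =
    ≤-trans (+-monoʳ-≤ _ (offset≤#sameBlockBelow 0<x closed))
      (length-filter-disjoint (_<? x) (_≤? boundaryBelow x) (λ y → (boundaryBelow x <? y) ×-dec (y <? x))
        (λ y y≤below → ≤-<-trans y≤below (boundaryBelow< 0<x)) (λ y → proj₂) (λ y y≤below (below<y , _) → <⇒≱ below<y y≤below) xs)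

  BlockClosed-tail : ∀ {x xs} → All (EarlierBlock x) xs → BlockClosed (x ∷ xs) → BlockClosed xs
  BlockClosed-tail {x} x-earlier closed {x′} x′∈xs y below<y y<x′ with closed (there x′∈xs) y below<y y<x′
  ... | there y∈xs = y∈xs
  ... | here refl  = ⊥-elim (<⇒≱ below<y (All.lookup x-earlier x′∈xs y<x′))

  crossCode+offsets≤inv : ∀ w → BlockDecreasing w → BlockClosed w → All (0 <_) w →
                          sum (crossCode w) + sum (map offset w) ≤ inv w
  crossCode+offsets≤inv []       _                         _      _              = z≤n
  crossCode+offsets≤inv (x ∷ xs) (x-earlier ∷ xs-decreasing) closed (0<x ∷ xs>0) = begin
    (c + sum (crossCode xs)) + (offset x + sum (map offset xs))
      ≡⟨ solve 4 (λ a b d e → (a :+ b) :+ (d :+ e) := (a :+ d) :+ (b :+ e)) refl c _ (offset x) _ ⟩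
    (c + offset x) + (sum (crossCode xs) + sum (map offset xs))
      ≤⟨ +-mono-≤ (crossCodeHead+offset≤ 0<x closed)
                  (crossCode+offsets≤inv xs xs-decreasing (BlockClosed-tail x-earlier closed) xs>0) ⟩
    length (filter (_<? x) xs) + inv xs ∎
    where
    open ≤-Reasoning
    c = length (filter (_≤? boundaryBelow x) xs)

  crossCodeHead< : ∀ {x₁ x₂ xs₁ xs₂} → x₁ < x₂ → x₁ ∷ xs₁ ↭ x₂ ∷ xs₂ → Unique (x₁ ∷ xs₁) → All (EarlierBlock x₁) xs₁ →
                   length (filter (_≤? boundaryBelow x₁) xs₁) < length (filter (_≤? boundaryBelow x₂) xs₂)
  crossCodeHead< {x₁} {x₂} {xs₁} {xs₂} x₁<x₂ w₁↭w₂ (x₁∉xs₁ ∷ xs₁!) x₁-earlier with boundaryBelow x₂ <? x₁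
  ... | yes below<x₁ = ⊥-elim (<⇒≱ below<x₁ (All.lookup x₁-earlier x₂∈xs₁ x₁<x₂))
    where
    x₂∈xs₁ : x₂ ∈ xs₁
    x₂∈xs₁ with ∈-resp-↭ (↭-sym w₁↭w₂) (here refl)
    ... | here x₂≡x₁ = ⊥-elim (<⇒≢ x₁<x₂ (sym x₂≡x₁))
    ... | there x₂∈  = x₂∈
  ... | no below≮x₁ = unique-⊆⇒length≤ (All.tabulate x₁≢ ∷ Unique-filter⁺ _ xs₁!) earlier⊆
    where
    x₁≤below : x₁ ≤ boundaryBelow x₂
    x₁≤below = ≮⇒≥ below≮x₁
    ∈xs₂ : ∀ {y} → y ∈ x₁ ∷ xs₁ → y < x₂ → y ∈ xs₂
    ∈xs₂ y∈w₁ y<x₂ with ∈-resp-↭ w₁↭w₂ y∈w₁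
    ... | here refl  = ⊥-elim (<-irrefl refl y<x₂)
    ... | there y∈xs₂ = y∈xs₂
    earlier⊆ : x₁ ∷ filter (_≤? boundaryBelow x₁) xs₁ ⊆ filter (_≤? boundaryBelow x₂) xs₂
    earlier⊆ (here refl) = ∈-filter⁺ _ (∈xs₂ (here refl) x₁<x₂) x₁≤below
    earlier⊆ (there y∈) with y∈xs₁ , y≤below₁ ← ∈-filter⁻ (_≤? boundaryBelow x₁) {xs = xs₁} y∈ =
      ∈-filter⁺ _ (∈xs₂ (there y∈xs₁) (≤-<-trans y≤x₁ x₁<x₂)) (≤-trans y≤x₁ x₁≤below)
      where
      y≤x₁ = ≤-trans y≤below₁ (boundaryBelow≤ x₁)
    x₁≢ : ∀ {y} → y ∈ filter (_≤? boundaryBelow x₁) xs₁ → x₁ ≢ y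
    x₁≢ y∈ = All.lookup x₁∉xs₁ (proj₁ (∈-filter⁻ (_≤? boundaryBelow x₁) {xs = xs₁} y∈))

  crossCode-injective : ∀ {w₁ w₂} → w₁ ↭ w₂ → Unique w₁ → Unique w₂ → BlockDecreasing w₁ → BlockDecreasing w₂ →
                        crossCode w₁ ≡ crossCode w₂ → w₁ ≡ w₂
  crossCode-injective {[]}     {[]}     _ _ _ _ _ _ = refl
  crossCode-injective {[]}     {_ ∷ _}  w₁↭w₂ _ _ _ _ _ with () ← ↭-length w₁↭w₂
  crossCode-injective {_ ∷ _}  {[]}     w₁↭w₂ _ _ _ _ _ with () ← ↭-length w₁↭w₂
  crossCode-injective {x₁ ∷ xs₁} {x₂ ∷ xs₂} w₁↭w₂ w₁! w₂! (x₁-earlier ∷ dec₁) (x₂-earlier ∷ dec₂) codes≡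
    with <-cmp x₁ x₂ | ∷-injective codes≡
  ... | tri< x₁<x₂ _ _ | head≡ , _ = ⊥-elim (<-irrefl head≡ (crossCodeHead< x₁<x₂ w₁↭w₂ w₁! x₁-earlier))
  ... | tri> _ _ x₂<x₁ | head≡ , _ = ⊥-elim (<-irrefl (sym head≡) (crossCodeHead< x₂<x₁ (↭-sym w₁↭w₂) w₂! x₂-earlier))
  ... | tri≈ _ refl _  | _ , tail≡ =
    cong (x₁ ∷_) (crossCode-injective (drop-∷ w₁↭w₂) (Unique.tail w₁!) (Unique.tail w₂!) dec₁ dec₂ tail≡)

  weight : ℕ → ℕ
  weight v = suc (offset v)

  NextBoundary : ℕ → ℕ → ℕ → Set
  NextBoundary n a b = a < b × b ≤ n × (b ≡ n ⊎ isBoundary b ≡ true) × (∀ c → a < c → c < b → isBoundary c ≡ false)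

  nextBoundary : ∀ {n} r a → suc a + r ≡ n → ∃ (NextBoundary n a)
  nextBoundary r a eq with isBoundary (suc a) in isBoundary-1+a
  ... | true = suc a , ≤-refl , subst (suc a ≤_) eq (m≤m+n (suc a) r) , inj₂ isBoundary-1+a , nothingBetween
    where
    nothingBetween : ∀ c → a < c → c < suc a → isBoundary c ≡ false
    nothingBetween c a<c c<1+a = ⊥-elim (<⇒≱ a<c (≤-pred c<1+a))
  nextBoundary zero a eq | false =
    suc a , ≤-refl , ≤-reflexive 1+a≡n , inj₁ 1+a≡n , λ c a<c c<1+a → ⊥-elim (<⇒≱ a<c (≤-pred c<1+a))
    where
    1+a≡n = trans (sym (+-identityʳ (suc a))) eq
  nextBoundary (suc r) a eq | false with b , 1+a<b , b≤n , b-end , nothingBetween ← nextBoundary r (suc a) (trans (sym (+-suc (suc a) r)) eq) =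
    b , <-trans ≤-refl 1+a<b , b≤n , b-end , nothingBetween′
    where
    nothingBetween′ : ∀ c → a < c → c < b → isBoundary c ≡ false
    nothingBetween′ c a<c c<b with m≤n⇒m<n∨m≡n a<c
    ... | inj₂ refl = isBoundary-1+a
    ... | inj₁ 1+a<c = nothingBetween c 1+a<c c<b

  sum-weights-block : ∀ {n a b} → isBoundary a ≡ true → NextBoundary n a b →
                      sum (map weight (interval (suc a) (b ∸ a))) ≡ suc (b ∸ a) C 2
  sum-weights-block {a = a} {b} isBoundary-a (a<b , _ , _ , nothingBetween) =
    trans (cong sum (map-cong-local (All.tabulate weight≡rank))) (sum-interval-ranks (suc a) (b ∸ a))
    where
    weight≡rank : ∀ {v} → v ∈ interval (suc a) (b ∸ a) → weight v ≡ suc (v ∸ suc a)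
    weight≡rank {v} v∈ with a<v , v<1+a+[b∸a] ← ∈-interval⁻ v∈ =
      cong (λ d → suc (v ∸ suc d)) (boundaryBelow-unique a v isBoundary-a a<v
        (λ c a<c c<v → nothingBetween c a<c (<-≤-trans c<v (≤-pred (subst (v <_) (cong suc (m+[n∸m]≡n (<⇒≤ a<b))) v<1+a+[b∸a])))))

  module _ {n : ℕ} {ws : List ℕ} (ws<n : All (_< n) ws)
           (condI : ∀ d → 0 < d → d < n → isBoundary d ≡ true → occ d ws ≤ 1)
           (condII : ∀ {a b} → isBoundary a ≡ true → NextBoundary n a b → between a b ws ≤ suc (b ∸ a) C 2 ∸ 1) where

    lettersAbove-n : lettersAbove n ws ≡ 0
    lettersAbove-n = cong length (filter-none (n <?_) (All.map <-asym ws<n))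

    occ-nextBoundary≤1 : ∀ {a b} → NextBoundary n a b → occ b ws ≤ 1
    occ-nextBoundary≤1 {a} {b} (a<b , b≤n , b-end , _) with m≤n⇒m<n∨m≡n b≤n | b-end
    ... | inj₁ b<n | inj₂ isBoundary-b = condI b (≤-trans (s≤s z≤n) a<b) b<n isBoundary-b
    ... | inj₁ b<n | inj₁ refl         = ⊥-elim (<-irrefl refl b<n)
    ... | inj₂ refl | _                = ≤-trans (≤-reflexive (cong length (filter-none (_≟ n) (All.map <⇒≢ ws<n)))) z≤n

    -- The fuel bounds n ∸ a, which drops with every block.
    lettersAbove≤ : ∀ fuel a → n ∸ a ≤ fuel → a ≤ n → isBoundary a ≡ true ⊎ a ≡ n →
                    lettersAbove a ws ≤ sum (map weight (interval (suc a) (n ∸ a)))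
    lettersAbove≤ fuel a _ a≤n (inj₂ refl) = subst (_≤ _) (sym lettersAbove-n) z≤n
    lettersAbove≤ fuel a _ a≤n (inj₁ isBoundary-a) with m≤n⇒m<n∨m≡n a≤n
    ... | inj₂ refl = subst (_≤ _) (sym lettersAbove-n) z≤n
    lettersAbove≤ zero a n∸a≤0 a≤n (inj₁ isBoundary-a) | inj₁ a<n = ⊥-elim (<⇒≱ (m<n⇒0<n∸m a<n) n∸a≤0)
    lettersAbove≤ (suc fuel) a n∸a≤1+fuel a≤n (inj₁ isBoundary-a) | inj₁ a<n
      with b , next@(a<b , b≤n , b-end , _) ← nextBoundary (n ∸ suc a) a (m+[n∸m]≡n a<n) = begin
      lettersAbove a ws                                            ≤⟨ lettersAbove-split a b ws ⟩
      between a b ws + (occ b ws + lettersAbove b ws)              ≤⟨ +-mono-≤ (condII isBoundary-a next) (+-mono-≤ (occ-nextBoundary≤1 next) IH) ⟩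
      (suc (b ∸ a) C 2 ∸ 1) + (1 + sum (map weight above-b))       ≡⟨ sym (+-assoc (suc (b ∸ a) C 2 ∸ 1) 1 _) ⟩
      (suc (b ∸ a) C 2 ∸ 1) + 1 + sum (map weight above-b)         ≡⟨ cong (_+ sum (map weight above-b)) (m∸n+n≡m 1≤C) ⟩
      suc (b ∸ a) C 2 + sum (map weight above-b)                   ≡⟨ cong (_+ sum (map weight above-b)) (sym (sum-weights-block isBoundary-a next)) ⟩
      sum (map weight (interval (suc a) (b ∸ a))) + sum (map weight above-b)
                                                                   ≡⟨ sym (sum-++ (map weight (interval (suc a) (b ∸ a))) _) ⟩
      sum (map weight (interval (suc a) (b ∸ a)) ++ map weight above-b)
                                                                   ≡⟨ cong sum (sym (map-++ weight (interval (suc a) (b ∸ a)) above-b)) ⟩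
      sum (map weight (interval (suc a) (b ∸ a) ++ above-b))       ≡⟨ cong (sum ∘ map weight) (sym (interval-split (s≤s (<⇒≤ a<b)) (s≤s b≤n))) ⟩
      sum (map weight (interval (suc a) (n ∸ a)))                  ∎
      where
      open ≤-Reasoning
      above-b = interval (suc b) (n ∸ b)
      1≤C : 1 ≤ suc (b ∸ a) C 2
      1≤C = 1≤[1+j]C2 (m<n⇒0<n∸m a<b)
      IH : lettersAbove b ws ≤ sum (map weight above-b)
      IH = lettersAbove≤ fuel b (≤-pred (<-≤-trans (∸-monoʳ-< a<b b≤n) n∸a≤1+fuel)) b≤n (swap b-end)

    length≤sum-weights : All (0 <_) ws → length ws ≤ sum (map weight (interval 1 n))
    length≤sum-weights ws>0 =
      subst (_≤ _) (cong length (filter-all (0 <?_) ws>0)) (lettersAbove≤ n 0 ≤-refl z≤n (inj₁ refl))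

perm-unique : ∀ {n w} → IsPerm n w → Unique w
perm-unique {n} w↭ = Unique-resp-↭ (↭-sym w↭) (subst Unique (sym (idPerm≡interval n)) (interval-unique 1 n))

Codes : ℕ → List ℕ → List ℕ → Set
Codes n w c = Σ (List Bool) λ flags → length flags ≡ n × c ≡ map fromBool flags ++ Blocks.crossCode (flagAt flags) w
            × Blocks.BlockDecreasing (flagAt flags) w × IsPerm n w

Codes-injective : ∀ {n w₁ w₂ c} → Codes n w₁ c → Codes n w₂ c → w₁ ≡ w₂
Codes-injective (flags₁ , len₁ , c≡₁ , dec₁ , w₁↭) (flags₂ , len₂ , c≡₂ , dec₂ , w₂↭)
  with flags≡ , crossCodes≡ ← ++-injective (map fromBool flags₁) (map fromBool flags₂)
                                    (trans (length-map fromBool flags₁) (trans (trans len₁ (sym len₂)) (sym (length-map fromBool flags₂))))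
                                    (trans (sym c≡₁) c≡₂)
  with refl ← map-injective fromBool-injective flags≡ =
  Blocks.crossCode-injective (flagAt flags₁) (↭-trans w₁↭ (↭-sym w₂↭)) (perm-unique w₁↭) (perm-unique w₂↭) dec₁ dec₂ crossCodes≡

module Spherical {n w I} (w↭ : IsPerm n w) (I⊆J : All (InJ n w) I) (spherical : ISpherical n w I) where

  flags : List Bool
  flags = applyUpTo (λ d → does (d ∈? I)) n

  open Blocks (flagAt flags)

  flag⇒∈I : ∀ {d} → flagAt flags d ≡ true → d ∈ I
  flag⇒∈I {d} flag≡true with d ∈? I | flagAt-applyUpTo (λ d → does (d ∈? I)) n flag≡true
  ... | yes d∈I | _ = d∈I

  ∈I⇒flag : ∀ {d} → d ∈ I → flagAt flags d ≡ true
  ∈I⇒flag {d} d∈I with 1≤d , d≤n∸1 , _ ← All.lookup I⊆J d∈I =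
    trans (flagAt-applyUpTo< (λ d → does (d ∈? I)) (≤∸1⇒< {n = n} 1≤d d≤n∸1)) (dec-true (d ∈? I) d∈I)

  boundary⇒∉I : ∀ {d} → isBoundary d ≡ true → d ∉ I
  boundary⇒∉I {zero}  _            d∈I with () ← proj₁ (All.lookup I⊆J d∈I)
  boundary⇒∉I {suc d} isBoundary-d d∈I rewrite ∈I⇒flag d∈I with () ← isBoundary-d

  ws : List ℕ
  ws = proj₁ spherical

  reduced : Reduced n w ws
  reduced = proj₁ (proj₂ spherical)

  ws<n : All (_< n) ws
  ws<n = All.map (λ (1≤i , i≤n∸1) → ≤∸1⇒< 1≤i i≤n∸1) (proj₁ reduced)

  ws>0 : All (0 <_) ws
  ws>0 = All.map proj₁ (proj₁ reduced)

  sphericalI : ∀ d → 0 < d → d < n → isBoundary d ≡ true → occ d ws ≤ 1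
  sphericalI d 0<d d<n isBoundary-d = proj₁ (proj₂ (proj₂ spherical)) d 0<d (<⇒≤∸1 d<n) (boundary⇒∉I isBoundary-d)

  sphericalII : ∀ {a b} → isBoundary a ≡ true → NextBoundary n a b → between a b ws ≤ suc (b ∸ a) C 2 ∸ 1
  sphericalII {a} {b} isBoundary-a (a<b , b≤n , b-end , nothingBetween) =
    subst (λ m → between a b ws ≤ m C 2 ∸ 1) (+-comm (b ∸ a) 1)
      (proj₂ (proj₂ (proj₂ spherical)) a b (boundary∈D (<-≤-trans a<b b≤n) isBoundary-a , b∈D (m≤n⇒m<n∨m≡n b≤n) b-end , a<b , inI))
    where
    boundary∈D : ∀ {d} → d < n → isBoundary d ≡ true → InD n I d
    boundary∈D {zero}  _   _            = inj₁ refl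
    boundary∈D {suc d} d<n isBoundary-d = inj₂ (inj₁ (s≤s z≤n , <⇒≤∸1 d<n , boundary⇒∉I isBoundary-d))
    b∈D : b < n ⊎ b ≡ n → b ≡ n ⊎ isBoundary b ≡ true → InD n I b
    b∈D _          (inj₁ b≡n)          = inj₂ (inj₂ b≡n)
    b∈D (inj₂ b≡n) _                   = inj₂ (inj₂ b≡n)
    b∈D (inj₁ b<n) (inj₂ isBoundary-b) = boundary∈D b<n isBoundary-b
    inI : ∀ c → a < c → c < b → c ∈ I
    inI c a<c c<b = flag⇒∈I (nonBoundary⇒∈I c (nothingBetween c a<c c<b))

  w↭interval : w ↭ interval 1 n
  w↭interval = subst (w ↭_) (idPerm≡interval n) w↭

  w-range : ∀ {x} → x ∈ w → 1 ≤ x × x < 1 + n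
  w-range x∈w = ∈-interval⁻ (∈-resp-↭ w↭interval x∈w)

  blockClosed : BlockClosed w
  blockClosed x∈w y below<y y<x =
    ∈-resp-↭ (↭-sym w↭interval) (∈-interval⁺ (≤-trans (s≤s z≤n) below<y) (<-trans y<x (proj₂ (w-range x∈w))))

  -- If x < y with x earlier in w were in the same block, the descents x, x+1, …, y-1 would put y before x.
  blockDecreasing-suffix : ∀ pre xs → pre ++ xs ≡ w → BlockDecreasing xs
  blockDecreasing-suffix pre []       _    = []
  blockDecreasing-suffix pre (x ∷ xs) split =
    All.tabulate earlier ∷ blockDecreasing-suffix (pre ++ [ x ]) xs (trans (++-assoc pre [ x ] xs) split)
    where
    earlier : ∀ {y} → y ∈ xs → EarlierBlock x y
    earlier {y} y∈xs x<y with boundaryBelow y <? x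
    ... | no below≮x = ≮⇒≥ below≮x
    ... | yes below<x = ⊥-elim (<-asym x-before-y y-before-x)
      where
      x-before-y : pos x w < pos y w
      x-before-y = subst (λ v → pos x v < pos y v) split (pos<pos pre (subst Unique (sym split) (perm-unique w↭)) y∈xs)
      y-before-x : pos y w < pos x w
      y-before-x = descents⇒pos< w x<y (λ i x≤i i<y →
        proj₂ (proj₂ (All.lookup I⊆J (flag⇒∈I (inside-block⇒∈I y i (<-≤-trans below<x x≤i) i<y)))))

  blockDecreasing : BlockDecreasing w
  blockDecreasing = blockDecreasing-suffix [] w refl

  sum-crossCode≤n : sum (crossCode w) ≤ n
  sum-crossCode≤n = +-cancelʳ-≤ (sum (map offset w)) _ _ (begin
    sum (crossCode w) + sum (map offset w) ≤⟨ crossCode+offsets≤inv w blockDecreasing blockClosed (All.tabulate (proj₁ ∘ w-range)) ⟩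
    inv w                                  ≡⟨ sym (proj₁ (proj₂ reduced)) ⟩
    length ws                              ≤⟨ length≤sum-weights ws<n sphericalI sphericalII ws>0 ⟩
    sum (map weight (interval 1 n))        ≡⟨ sum-↭ (map⁺ weight (↭-sym w↭interval)) ⟩
    sum (map weight w)                     ≡⟨ sum-map-suc offset w ⟩
    sum (map offset w) + length w          ≡⟨ +-comm _ (length w) ⟩
    length w + sum (map offset w)          ≡⟨ cong (_+ sum (map offset w)) (trans (↭-length w↭interval) (length-interval 1 n)) ⟩
    n + sum (map offset w)                 ∎)
    where open ≤-Reasoning

  code : List ℕ
  code = map fromBool flags ++ crossCode w

  codes : Codes n w code
  codes = flags , length-applyUpTo _ n , refl , blockDecreasing , w↭

  code∈boundedSumLists : code ∈ boundedSumLists (n + n) (n + n)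
  code∈boundedSumLists = ∈-boundedSumLists (n + n) (n + n) code
    (trans (length-++ (map fromBool flags))
           (cong₂ _+_ (trans (length-map fromBool flags) (length-applyUpTo _ n))
                      (trans (length-crossCode w) (trans (↭-length w↭interval) (length-interval 1 n)))))
    (subst (_≤ n + n) (sym (sum-++ (map fromBool flags) (crossCode w)))
      (+-mono-≤ (≤-trans (sum-map-fromBool≤length flags) (≤-reflexive (length-applyUpTo _ n))) sum-crossCode≤n))

#spherical≤16^n : ∀ n {L} → Unique L → All (λ w → IsPerm n w × SomeSpherical n w) L → length L ≤ 16 ^ n
#spherical≤16^n n {L} L! spherical = begin
  length L                                         ≤⟨ length≤-of-injective-code (Codes n) Codes-injective _ L! (All.map coded spherical) ⟩
  length (boundedSumLists (n + n) (n + n))         ≤⟨ length-boundedSumLists (n + n) (n + n) ⟩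
  2 ^ ((n + n) + (n + n))                          ≡⟨ cong (2 ^_) (solve 1 (λ n → (n :+ n) :+ (n :+ n) := con 4 :* n) refl n) ⟩
  2 ^ (4 * n)                                      ≡⟨ sym (^-*-assoc 2 4 n) ⟩
  16 ^ n                                           ∎
  where
  open ≤-Reasoning
  coded : ∀ {w} → IsPerm n w × SomeSpherical n w → ∃ λ c → c ∈ boundedSumLists (n + n) (n + n) × Codes n w c
  coded (w↭ , _ , I⊆J , sph) = code , code∈boundedSumLists , codes
    where open Spherical w↭ I⊆J sph

maximal⇒someSpherical : ∀ {n w} → MaxSpherical n w → SomeSpherical n w
maximal⇒someSpherical (I , I⇔J , sph) = I , All.tabulate (λ {i} i∈I → Equivalence.to (I⇔J i) i∈I) , sph

k*16^n<n! : ∀ k n → 64 + k ≤ n → k * 16 ^ n < n !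
k*16^n<n! = *-^<! 16 64 (≤ᵇ⇒≤ 32 65 _) (≤ᵇ⇒≤ (16 ^ 64) (64 !) _)

probTendsToZero : ∀ {P} → (∀ {n w} → P n w → SomeSpherical n w) → ProbTendsToZero P
probTendsToZero P⇒spherical k = 64 + k , λ n 64+k≤n L L! L⊆P →
  ≤-<-trans (*-monoʳ-≤ k (#spherical≤16^n n L! (All.map (Product.map₂ P⇒spherical) L⊆P))) (k*16^n<n! k n 64+k≤n)

corollary1p4 : ProbTendsToZero SomeSpherical × ProbTendsToZero MaxSpherical
corollary1p4 = probTendsToZero id , probTendsToZero maximal⇒someSpherical
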